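{- Let $p$ be a prime, and let $r,s$ be integers with $0 \leq s \leq r \leq p-1$. The following are equivalent: 1. $(r,s) \in D(p)$; 2. $H_r \equiv H_{r-s} \equiv H_s \pmod p$; 3. $\binom{r}{s} \equiv (-1)^{r-s}\binom{p-1-s}{r-s} \equiv (-1)^s\binom{p-1-r+s}{s} \pmod{p^2}$.
   Context: For a prime $p$, $D(p)$ denotes the set of pairs $(r,s) \in \{0,1,\dots,p-1\}^2$ such that $\binom{pa+r}{pb+s} \equiv \binom{a}{b}\binom{r}{s} \pmod{p^2}$ for all integers $a \geq 0$ and $b \geq 0$ (binomial coefficients $\binom{n}{k}$ with $k>n\geq 0$ are $0$). $H_n = 1 + \frac12 + \dots + \frac1n$ is the $n$th harmonic number, with $H_0 = 0$; for $0 \leq n \leq p-1$ its denominator is coprime to $p$, so it can be reduced modulo $p$. -}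

module Defs where

open import Data.Nat as ℕ using (ℕ; zero; suc; _∸_)
open import Data.Nat.Combinatorics using (_C_)
open import Data.Integer as ℤ using (ℤ; +_)
open import Data.Integer.Divisibility as ℤD using ()
open import Data.Nat.Divisibility as ℕD using ()
open import Data.Rational as ℚ using (ℚ; ↥_)

infix 4 _≡ℤ_[mod_] _≡ℚ_[mod_]
_≡ℤ_[mod_] : ℤ → ℤ → ℕ → Set
x ≡ℤ y [mod m ] = (+ m) ℤD.∣ (x ℤ.- y)

Cℤ : ℕ → ℕ → ℤ
Cℤ n k = + (n C k)

InD : ℕ → ℕ → ℕ → Set
InD p r s = ∀ (a b : ℕ) →
  Cℤ (p ℕ.* a ℕ.+ r) (p ℕ.* b ℕ.+ s) ≡ℤ (Cℤ a b ℤ.* Cℤ r s) [mod p ℕ.* p ]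

H : ℕ → ℚ
H zero    = ℚ.0ℚ
H (suc n) = H n ℚ.+ (+ 1 ℚ./ suc n)

-- Congruence of rationals modulo p: p divides the numerator of the
-- reduced form of x - y (the usual meaning for p-integral rationals).
_≡ℚ_[mod_] : ℚ → ℚ → ℕ → Set
x ≡ℚ y [mod p ] = p ℕD.∣ ℤ.∣ ↥ (x ℚ.- y) ∣

module Submission where

-- Let E_n = n! H_n ∈ ℕ and A_x(n) = ∏_{i=1}^{n} (p x + i), so that
-- (px + n)! = (px)! A_x(n) and, to first order in p, A_x(n) ≡ n! + p x E_n (mod p²).
-- For a = b + c, the factorial identity
--   C(pa + r, pb + s) A_b(s) A_c(u) = C(pa, pb) A_a(r),
-- Lucas' theorem modulo p² (C(pa, pb) ≡ C(a, b), from Vandermonde) and the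
-- expansion give the key congruence
--   (C(pa + r, pb + s) - C(a,b) C(r,s)) (s! u! + p W) ≡ p C(a,b) Z  (mod p²),
-- where s! u! Z = b u! Δ_s + c s! Δ_u and Δ_t = E_r t! - E_t r!.  As s! u! is a
-- unit mod p, (r, s) ∈ D(p) iff p ∣ Δ_s and p ∣ Δ_u (the pairs (a,b) = (1,1) and
-- (1,0) give one direction), and p ∣ Δ_t says exactly H_r ≡ H_t.  At x = -1 the
-- identity (-1)^u C(p-1-s, u) u! A_{-1}(s) = A_{-1}(r) shows in the same way that
-- C(r,s) ≡ (-1)^u C(p-1-s, u) iff p ∣ Δ_s; exchanging s and u handles Δ_u.

open import Data.Nat.Base using (ℕ; suc)
open import Data.Nat.Primality using (Prime)
open import Defs

module Binomial where

  open import Data.Nat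
  open import Data.Nat.Properties
  open import Data.Nat.Combinatorics
    using (_C_; nCk≡n!/k![n-k]!; k![n∸k]!∣n!; k>n⇒nCk≡0; nCk+nC[k+1]≡[n+1]C[k+1])
  open import Data.Nat.DivMod using (m*[n/m]≡n)
  open import Data.Nat.Divisibility using (_∣_; _∣0; ∣m∣n⇒∣m+n)
  open import Data.Nat.Tactic.RingSolver using (solve-∀)
  open import Relation.Nullary using (yes; no)
  open import Relation.Binary.PropositionalEquality
  open ≡-Reasoning

  C*factorials≡! : ∀ n k → k ≤ n → (n C k) * (k ! * (n ∸ k) !) ≡ n !
  C*factorials≡! n k k≤n = begin
    (n C k) * (k ! * (n ∸ k) !)  ≡⟨ cong (_* (k ! * (n ∸ k) !)) (nCk≡n!/k![n-k]! k≤n) ⟩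
    (n ! / (k ! * (n ∸ k) !)) * (k ! * (n ∸ k) !)
      ≡⟨ *-comm _ (k ! * (n ∸ k) !) ⟩
    (k ! * (n ∸ k) !) * (n ! / (k ! * (n ∸ k) !))
      ≡⟨ m*[n/m]≡n (k![n∸k]!∣n! k≤n) ⟩
    n ! ∎
    where instance _ = k !* (n ∸ k) !≢0

  absorption : ∀ n m → (n C suc m) * suc m ≡ n * ((n ∸ 1) C m)
  absorption zero m = refl
  absorption (suc n) m with m ≤? n
  ... | no m≰n = begin
    (suc n C suc m) * suc m  ≡⟨ cong (_* suc m) (k>n⇒nCk≡0 (s≤s (≰⇒> m≰n))) ⟩
    0                        ≡⟨ *-zeroʳ (suc n) ⟨
    suc n * 0                ≡⟨ cong (suc n *_) (k>n⇒nCk≡0 (≰⇒> m≰n)) ⟨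
    suc n * (n C m)          ∎
  ... | yes m≤n = *-cancelʳ-≡ _ _ (m ! * (n ∸ m) !) {{m !* (n ∸ m) !≢0}} (begin
    (suc n C suc m) * suc m * (m ! * (n ∸ m) !)  ≡⟨ reassoc (suc n C suc m) (suc m) (m !) _ ⟩
    (suc n C suc m) * (suc m ! * (n ∸ m) !)      ≡⟨ C*factorials≡! (suc n) (suc m) (s≤s m≤n) ⟩
    suc n !                                      ≡⟨ cong (suc n *_) (C*factorials≡! n m m≤n) ⟨
    suc n * ((n C m) * (m ! * (n ∸ m) !))        ≡⟨ *-assoc (suc n) (n C m) _ ⟨
    suc n * (n C m) * (m ! * (n ∸ m) !)          ∎)
    where
    reassoc : ∀ c k f g → c * k * (f * g) ≡ c * (k * f * g)
    reassoc = solve-∀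

  -- convolution f g k = Σ_{i ≤ k} f(i) · g(k - i), by recursion on k
  -- (the first factor is shifted in the recursive call).
  convolution : (ℕ → ℕ) → (ℕ → ℕ) → ℕ → ℕ
  convolution f g zero    = f 0 * g 0
  convolution f g (suc k) = f 0 * g (suc k) + convolution (λ i → f (suc i)) g k

  convolution-cong : ∀ f f′ g k → (∀ i → f i ≡ f′ i) → convolution f g k ≡ convolution f′ g k
  convolution-cong f f′ g zero    f≗f′ = cong (_* g 0) (f≗f′ 0)
  convolution-cong f f′ g (suc k) f≗f′ =
    cong₂ _+_ (cong (_* g (suc k)) (f≗f′ 0)) (convolution-cong _ _ g k (λ i → f≗f′ (suc i)))

  convolution-+ : ∀ f h g k →
    convolution (λ i → f i + h i) g k ≡ convolution f g k + convolution h g k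
  convolution-+ f h g zero    = *-distribʳ-+ (g 0) (f 0) (h 0)
  convolution-+ f h g (suc k) = begin
    (f 0 + h 0) * g (suc k) + convolution (λ i → f (suc i) + h (suc i)) g k
      ≡⟨ cong₂ _+_ (*-distribʳ-+ (g (suc k)) (f 0) (h 0)) (convolution-+ _ _ g k) ⟩
    (f 0 * g (suc k) + h 0 * g (suc k)) + (convolution f′ g k + convolution h′ g k)
      ≡⟨ interchange (f 0 * g (suc k)) _ _ _ ⟩
    (f 0 * g (suc k) + convolution f′ g k) + (h 0 * g (suc k) + convolution h′ g k) ∎
    where
    f′ h′ : ℕ → ℕ
    f′ i = f (suc i)
    h′ i = h (suc i)
    interchange : ∀ a b c d → (a + b) + (c + d) ≡ (a + c) + (b + d)
    interchange = solve-∀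

  convolution-unit : ∀ f g k → f 0 ≡ 1 → (∀ i → f (suc i) ≡ 0) → convolution f g k ≡ g k
  convolution-unit f g zero    f0≡1 _    = trans (cong (_* g 0) f0≡1) (+-identityʳ (g 0))
  convolution-unit f g (suc k) f0≡1 rest = begin
    f 0 * g (suc k) + convolution (λ i → f (suc i)) g k
      ≡⟨ cong₂ _+_ (cong (_* g (suc k)) f0≡1) (vanish (λ i → f (suc i)) k rest) ⟩
    1 * g (suc k) + 0  ≡⟨ +-identityʳ (1 * g (suc k)) ⟩
    1 * g (suc k)      ≡⟨ *-identityˡ (g (suc k)) ⟩
    g (suc k)          ∎
    where
    vanish : ∀ f k → (∀ i → f i ≡ 0) → convolution f g k ≡ 0
    vanish f zero    f≡0 = cong (_* g 0) (f≡0 0)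
    vanish f (suc k) f≡0 = cong₂ _+_ (cong (_* g (suc k)) (f≡0 0)) (vanish _ k (λ i → f≡0 (suc i)))

  vandermonde : ∀ j n k → (j + n) C k ≡ convolution (j C_) (n C_) k
  vandermonde zero    n k       = sym (convolution-unit (0 C_) (n C_) k refl (λ _ → refl))
  vandermonde (suc j) n zero    = refl
  vandermonde (suc j) n (suc k) = begin
    suc (j + n) C suc k  ≡⟨ nCk+nC[k+1]≡[n+1]C[k+1] (j + n) k ⟨
    (j + n) C k + (j + n) C suc k
      ≡⟨ cong₂ _+_ (vandermonde j n k) (vandermonde j n (suc k)) ⟩
    convolution (j C_) g k + (1 * g (suc k) + convolution (λ i → j C suc i) g k)
      ≡⟨ rearrange (convolution (j C_) g k) (g (suc k)) _ ⟩
    1 * g (suc k) + (convolution (j C_) g k + convolution (λ i → j C suc i) g k)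
      ≡⟨ cong (1 * g (suc k) +_) (convolution-+ (j C_) (λ i → j C suc i) g k) ⟨
    1 * g (suc k) + convolution (λ i → j C i + j C suc i) g k
      ≡⟨ cong (1 * g (suc k) +_) (convolution-cong _ _ g k (nCk+nC[k+1]≡[n+1]C[k+1] j)) ⟩
    convolution (suc j C_) g (suc k) ∎
    where
    g : ℕ → ℕ
    g = n C_
    rearrange : ∀ a b c → a + (1 * b + c) ≡ 1 * b + (a + c)
    rearrange = solve-∀

  -- The first m terms of a convolution of length m + k + 1:
  -- Σ_{i < m} f(i) · g(m + k - i).
  leadingTerms : ℕ → (ℕ → ℕ) → (ℕ → ℕ) → ℕ → ℕ
  leadingTerms zero    f g k = 0
  leadingTerms (suc m) f g k = f 0 * g (suc m + k) + leadingTerms m (λ i → f (suc i)) g k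

  convolution-split : ∀ m f g k →
    convolution f g (m + k) ≡ leadingTerms m f g k + convolution (λ i → f (m + i)) g k
  convolution-split zero    f g k = refl
  convolution-split (suc m) f g k =
    trans (cong (f 0 * g (suc m + k) +_) (convolution-split m (λ i → f (suc i)) g k))
          (sym (+-assoc (f 0 * g (suc m + k)) _ _))

  leadingTerms-∣ : ∀ d m f g k → (∀ i → i < m → d ∣ f i * g (m + k ∸ i)) → d ∣ leadingTerms m f g k
  leadingTerms-∣ d zero    f g k _   = d ∣0
  leadingTerms-∣ d (suc m) f g k d∣ = ∣m∣n⇒∣m+n (d∣ 0 (s≤s z≤n))
    (leadingTerms-∣ d m (λ i → f (suc i)) g k (λ i i<m → d∣ (suc i) (s≤s i<m)))

-- Divisibility by a prime p = q + 1 of factorials and of binomial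
-- coefficients, and the inductive step of Lucas' theorem modulo p²:
-- by Vandermonde, C(p(a+1), p(b+1)) = Σ_i C(p,i) C(pa, p(b+1) - i), and all
-- terms with 0 < i < p are products of two multiples of p.
module PrimeDivisibility (q : ℕ) (isPrime : Prime (suc q)) where

  open import Data.Nat
  open import Data.Nat.Properties
  open import Data.Nat.Combinatorics using (_C_; nCn≡1; k>n⇒nCk≡0)
  open import Data.Nat.Divisibility
  open import Data.Nat.Primality using (Prime; euclidsLemma; prime⇒nonTrivial)
  open import Data.Sum using (inj₁; inj₂)
  open import Relation.Nullary using (¬_; contradiction)
  open import Relation.Binary.PropositionalEquality
  open Binomial

  p : ℕ
  p = suc q

  p∤positive<p : ∀ m → 0 < m → m < p → ¬ p ∣ m
  p∤positive<p (suc m) _ m<p = >⇒∤ m<p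

  p∤! : ∀ n → n < p → ¬ p ∣ n !
  p∤! zero    _   = >⇒∤ (nonTrivial⇒n>1 p {{prime⇒nonTrivial isPrime}})
  p∤! (suc n) n<p p∣ with euclidsLemma (suc n) (n !) isPrime p∣
  ... | inj₁ p∣suc = p∤positive<p (suc n) (s≤s z≤n) n<p p∣suc
  ... | inj₂ p∣!   = p∤! n (<-trans (n<1+n n) n<p) p∣!

  -- p ∣ C(pa, m) whenever p ∤ m, since C(pa, m) · m = pa · C(pa - 1, m - 1).
  p∣C[pa,m] : ∀ a m → ¬ p ∣ m → p ∣ (p * a) C m
  p∣C[pa,m] a zero    p∤0 = contradiction (p ∣0) p∤0
  p∣C[pa,m] a (suc m) p∤m with euclidsLemma ((p * a) C suc m) (suc m) isPrime
    (subst (p ∣_) (sym (absorption (p * a) m)) (∣m⇒∣m*n _ (m∣m*n a)))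
  ... | inj₁ p∣C = p∣C
  ... | inj₂ p∣m = contradiction p∣m p∤m

  p∣C[p,i] : ∀ i → i < q → p ∣ p C suc i
  p∣C[p,i] i i<q = subst (λ n → p ∣ n C suc i) (*-identityʳ p)
    (p∣C[pa,m] 1 (suc i) (p∤positive<p (suc i) (s≤s z≤n) (s≤s i<q)))

  -- The terms 0 < i < p of the Vandermonde expansion of C(p(a+1), p(b+1)).
  lucasMiddle : ℕ → ℕ → ℕ
  lucasMiddle a b = leadingTerms q (λ i → p C suc i) ((p * a) C_) (p * b)

  lucasMiddle-∣ : ∀ a b → p * p ∣ lucasMiddle a b
  lucasMiddle-∣ a b = leadingTerms-∣ (p * p) q _ _ (p * b)
    (λ i i<q → *-pres-∣ (p∣C[p,i] i i<q) (p∣C[pa,m] a _ (p∤index i i<q)))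
    where
    -- the index q + pb - i is congruent to -(i + 1) modulo p
    p∤index : ∀ i → i < q → ¬ p ∣ q + p * b ∸ i
    p∤index i i<q p∣ = p∤positive<p (suc i) (s≤s z≤n) (s≤s i<q) (∣m+n∣m⇒∣n p∣sum p∣)
      where
      sum≡ : (q + p * b ∸ i) + suc i ≡ p + p * b
      sum≡ = trans (+-suc _ i) (cong suc (m∸n+n≡m (≤-trans (<⇒≤ i<q) (m≤m+n q (p * b)))))
      p∣sum : p ∣ (q + p * b ∸ i) + suc i
      p∣sum = subst (p ∣_) (sym sum≡) (∣m∣n⇒∣m+n (∣-refl {p}) (m∣m*n b))

  lucasStep : ∀ a b →
    (p * suc a) C (p * suc b) ≡ (p * a) C (p * suc b) + lucasMiddle a b + (p * a) C (p * b)
  lucasStep a b = begin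
    (p * suc a) C (p * suc b)  ≡⟨ cong₂ _C_ (*-suc p a) (*-suc p b) ⟩
    (p + p * a) C (p + p * b)  ≡⟨ vandermonde p (p * a) (p + p * b) ⟩
    convolution (p C_) g (p + p * b)  ≡⟨ convolution-split p (p C_) g (p * b) ⟩
    (1 * g (p + p * b) + lucasMiddle a b) + convolution (λ i → p C (p + i)) g (p * b)
      ≡⟨ cong₂ (λ x y → x + lucasMiddle a b + y) first tail ⟩
    g (p * suc b) + lucasMiddle a b + g (p * b) ∎
    where
    open ≡-Reasoning
    g : ℕ → ℕ
    g = (p * a) C_
    first : 1 * g (p + p * b) ≡ g (p * suc b)
    first = trans (*-identityˡ _) (cong g (sym (*-suc p b)))
    -- only the term C(p, p) = 1 survives beyond the middle
    tail : convolution (λ i → p C (p + i)) g (p * b) ≡ g (p * b)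
    tail = convolution-unit _ g (p * b) (trans (cong (p C_) (+-identityʳ p)) (nCn≡1 p))
      (λ i → k>n⇒nCk≡0 (subst (p <_) (sym (+-suc p i)) (s≤s (m≤m+n p i))))

module Arithmetic where

  open import Data.Nat as ℕ using (ℕ; zero; suc; _≤_; _<_; _∸_; _!; s≤s)
  import Data.Nat.Properties as ℕP
  open Binomial using (C*factorials≡!)
  open import Data.Nat.Combinatorics using (_C_; nCk+nC[k+1]≡[n+1]C[k+1]; nCk≡nC[n∸k])
  open import Data.Integer as ℤ using (ℤ; +_; _+_; _*_; _-_; -_; _^_; -1ℤ; 0ℤ; 1ℤ; ∣_∣)
  import Data.Integer.Properties as ℤP
  open import Data.Integer.Divisibility.Signed as ℤ∣ using (_∣_; divides)
  open import Data.Integer.Tactic.RingSolver using (solve-∀)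
  import Data.Nat.Tactic.RingSolver as ℕSolver
  open import Data.Product using (_,_; _×_)
  open import Level using (0ℓ)
  open import Relation.Binary.Bundles using (Setoid)
  open import Relation.Binary.PropositionalEquality
  import Relation.Binary.Reasoning.Setoid
  open import Function.Bundles using (_⇔_; mk⇔)
  import Function.Properties.Equivalence as ⇔
  open import Data.Product.Function.NonDependent.Propositional using (_×-⇔_)

  -- Congruence of integers modulo an integer m:  m ∣ x - y.  A record rather
  -- than a definition, so that x and y can be inferred from the type.
  infix 4 _≈_[mod_]
  record _≈_[mod_] (x y m : ℤ) : Set where
    constructor mod∣
    field difference-divisible : m ∣ x - y
  open _≈_[mod_] public

  module _ {m : ℤ} where

    ≈-reflexive : ∀ {x y} → x ≡ y → x ≈ y [mod m ]
    ≈-reflexive {x} refl =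
      mod∣ (subst (m ∣_) (sym (ℤP.+-inverseʳ x)) (ℤ∣.∣n⇒∣m*n 0ℤ (ℤ∣.∣-refl {m})))

    ≈-refl : ∀ {x} → x ≈ x [mod m ]
    ≈-refl = ≈-reflexive refl

    ≈-sym : ∀ {x y} → x ≈ y [mod m ] → y ≈ x [mod m ]
    ≈-sym {x} {y} (mod∣ d) = mod∣ (subst (m ∣_) (flip x y) (ℤ∣.∣m⇒∣-m d))
      where
      flip : ∀ x y → - (x - y) ≡ y - x
      flip = solve-∀

    ≈-trans : ∀ {x y z} → x ≈ y [mod m ] → y ≈ z [mod m ] → x ≈ z [mod m ]
    ≈-trans {x} {y} {z} (mod∣ d) (mod∣ e) =
      mod∣ (subst (m ∣_) (ℤP.+-minus-telescope x y z) (ℤ∣.∣m∣n⇒∣m+n d e))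

    ≈-+ : ∀ {x x′ y y′} → x ≈ x′ [mod m ] → y ≈ y′ [mod m ] → x + y ≈ x′ + y′ [mod m ]
    ≈-+ {x} {x′} {y} {y′} (mod∣ d) (mod∣ e) =
      mod∣ (subst (m ∣_) (split x x′ y y′) (ℤ∣.∣m∣n⇒∣m+n d e))
      where
      split : ∀ x x′ y y′ → (x - x′) + (y - y′) ≡ (x + y) - (x′ + y′)
      split = solve-∀

    ≈-* : ∀ {x x′ y y′} → x ≈ x′ [mod m ] → y ≈ y′ [mod m ] → x * y ≈ x′ * y′ [mod m ]
    ≈-* {x} {x′} {y} {y′} (mod∣ d) (mod∣ e) =
      mod∣ (subst (m ∣_) (split x x′ y y′)
        (ℤ∣.∣m∣n⇒∣m+n (ℤ∣.∣m⇒∣m*n y d) (ℤ∣.∣n⇒∣m*n x′ e)))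
      where
      split : ∀ x x′ y y′ → (x - x′) * y + x′ * (y - y′) ≡ x * y - x′ * y′
      split = solve-∀

    ≈-+ˡ : ∀ z {y y′} → y ≈ y′ [mod m ] → z + y ≈ z + y′ [mod m ]
    ≈-+ˡ z = ≈-+ (≈-refl {z})

    ≈-+ʳ : ∀ z {x x′} → x ≈ x′ [mod m ] → x + z ≈ x′ + z [mod m ]
    ≈-+ʳ z x≈x′ = ≈-+ x≈x′ (≈-refl {z})

    ≈-*ˡ : ∀ z {y y′} → y ≈ y′ [mod m ] → z * y ≈ z * y′ [mod m ]
    ≈-*ˡ z = ≈-* (≈-refl {z})

    ≈-*ʳ : ∀ z {x x′} → x ≈ x′ [mod m ] → x * z ≈ x′ * z [mod m ]
    ≈-*ʳ z x≈x′ = ≈-* x≈x′ (≈-refl {z})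

    ≈-neg : ∀ {x y} → x ≈ y [mod m ] → - x ≈ - y [mod m ]
    ≈-neg {x} {y} (mod∣ d) = mod∣ (subst (m ∣_) (negate x y) (ℤ∣.∣m⇒∣-m d))
      where
      negate : ∀ x y → - (x - y) ≡ - x - - y
      negate = solve-∀

    ≈-+multiple : ∀ x k → x + k * m ≈ x [mod m ]
    ≈-+multiple x k = mod∣ (subst (m ∣_) (cancel x k m) (ℤ∣.∣n⇒∣m*n k (ℤ∣.∣-refl {m})))
      where
      cancel : ∀ x k m → k * m ≡ x + k * m - x
      cancel = solve-∀

    ∣⇒≈0 : ∀ {x} → m ∣ x → x ≈ 0ℤ [mod m ]
    ∣⇒≈0 {x} d = mod∣ (subst (m ∣_) (sym (ℤP.+-identityʳ x)) d)

    ≈0⇒∣ : ∀ {x} → x ≈ 0ℤ [mod m ] → m ∣ x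
    ≈0⇒∣ {x} (mod∣ d) = subst (m ∣_) (ℤP.+-identityʳ x) d

  modSetoid : ℤ → Setoid 0ℓ 0ℓ
  modSetoid m = record
    { Carrier = ℤ
    ; _≈_ = λ x y → x ≈ y [mod m ]
    ; isEquivalence = record { refl = ≈-refl ; sym = ≈-sym ; trans = ≈-trans }
    }

  module ≈-Reasoning (m : ℤ) = Relation.Binary.Reasoning.Setoid (modSetoid m)


  -- Factorials and the harmonic numerators n! · H_n, as integers.
  harmonicNumerator : ℕ → ℕ
  harmonicNumerator zero    = 0
  harmonicNumerator (suc n) = harmonicNumerator n ℕ.* suc n ℕ.+ n !

  fact : ℕ → ℤ
  fact n = + (n !)

  hnum : ℕ → ℤ
  hnum n = + harmonicNumerator n

  fact-suc : ∀ n → fact (suc n) ≡ fact n * + suc n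
  fact-suc n = trans (ℤP.pos-* (suc n) (n !)) (ℤP.*-comm (+ suc n) (fact n))

  hnum-suc : ∀ n → hnum (suc n) ≡ hnum n * + suc n + fact n
  hnum-suc n = trans (ℤP.pos-+ _ (n !)) (cong (_+ fact n) (ℤP.pos-* (harmonicNumerator n) (suc n)))

  -- shifted P x n = ∏_{i=1}^{n} (P x + i), so that (p x + n)! = (p x)! · shifted p x n.
  shifted : ℤ → ℤ → ℕ → ℤ
  shifted P x zero    = 1ℤ
  shifted P x (suc n) = shifted P x n * (P * x + + suc n)

  shifted-expansion : ∀ P x n → shifted P x n ≈ fact n + P * x * hnum n [mod P * P ]
  shifted-expansion P x zero    = ≈-reflexive (no-correction P x)
    where
    no-correction : ∀ P x → 1ℤ ≡ 1ℤ + P * x * 0ℤ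
    no-correction = solve-∀
  shifted-expansion P x (suc n) = begin
    shifted P x n * (P * x + + suc n)               ≈⟨ ≈-*ʳ (P * x + + suc n) (shifted-expansion P x n) ⟩
    (fact n + P * x * hnum n) * (P * x + + suc n)    ≡⟨ expand (fact n) (hnum n) P x (+ suc n) ⟩
    fact n * + suc n + P * x * (hnum n * + suc n + fact n) + x * x * hnum n * (P * P)
                                                    ≈⟨ ≈-+multiple _ (x * x * hnum n) ⟩
    fact n * + suc n + P * x * (hnum n * + suc n + fact n)
                                                    ≡⟨ cong₂ (λ f e → f + P * x * e) (fact-suc n) (hnum-suc n) ⟨
    fact (suc n) + P * x * hnum (suc n)             ∎
    where
    open ≈-Reasoning (P * P)
    expand : ∀ f e P x m → (f + P * x * e) * (P * x + m) ≡ f * m + P * x * (e * m + f) + x * x * e * (P * P)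
    expand = solve-∀

  Cℤ-factorials : ∀ n k → k ≤ n → Cℤ n k * (fact k * fact (n ∸ k)) ≡ fact n
  Cℤ-factorials n k k≤n = begin
    Cℤ n k * (fact k * fact (n ∸ k))  ≡⟨ cong (Cℤ n k *_) (ℤP.pos-* (k !) ((n ∸ k) !)) ⟨
    Cℤ n k * + (k ! ℕ.* (n ∸ k) !)    ≡⟨ ℤP.pos-* (n C k) _ ⟨
    + ((n C k) ℕ.* (k ! ℕ.* (n ∸ k) !)) ≡⟨ cong +_ (C*factorials≡! n k k≤n) ⟩
    fact n                            ∎
    where open ≡-Reasoning

  fact-cancel : ∀ n x y → x * fact n ≡ y * fact n → x ≡ y
  fact-cancel n x y = ℤP.*-cancelʳ-≡ x y (fact n) {{n !≢0}}
    where open ℕP using (_!≢0)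

  fact-shifted : ∀ p x n → fact (p ℕ.* x ℕ.+ n) ≡ fact (p ℕ.* x) * shifted (+ p) (+ x) n
  fact-shifted p x zero    = trans (cong fact (ℕP.+-identityʳ (p ℕ.* x))) (sym (ℤP.*-identityʳ _))
  fact-shifted p x (suc n) = begin
    fact (p ℕ.* x ℕ.+ suc n)                      ≡⟨ cong fact (ℕP.+-suc (p ℕ.* x) n) ⟩
    fact (suc (p ℕ.* x ℕ.+ n))                    ≡⟨ fact-suc (p ℕ.* x ℕ.+ n) ⟩
    fact (p ℕ.* x ℕ.+ n) * + suc (p ℕ.* x ℕ.+ n)  ≡⟨ cong₂ _*_ (fact-shifted p x n) last-factor ⟩
    fact (p ℕ.* x) * shifted (+ p) (+ x) n * (+ p * + x + + suc n)
                                                  ≡⟨ ℤP.*-assoc (fact (p ℕ.* x)) _ _ ⟩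
    fact (p ℕ.* x) * shifted (+ p) (+ x) (suc n)  ∎
    where
    open ≡-Reasoning
    last-factor : + suc (p ℕ.* x ℕ.+ n) ≡ + p * + x + + suc n
    last-factor = begin
      + suc (p ℕ.* x ℕ.+ n)  ≡⟨ cong +_ (ℕP.+-suc (p ℕ.* x) n) ⟨
      + (p ℕ.* x ℕ.+ suc n)  ≡⟨ ℤP.pos-+ (p ℕ.* x) (suc n) ⟩
      + (p ℕ.* x) + + suc n  ≡⟨ cong (_+ + suc n) (ℤP.pos-* p x) ⟩
      + p * + x + + suc n    ∎

  -- The identity behind the theorem: both sides, multiplied by (pb)! (pc)!,
  -- equal (p(b+c) + s + u)!.
  binomial-shifted : ∀ p b c s u →
    Cℤ (p ℕ.* (b ℕ.+ c) ℕ.+ (s ℕ.+ u)) (p ℕ.* b ℕ.+ s) * shifted (+ p) (+ b) s * shifted (+ p) (+ c) u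
      ≡ Cℤ (p ℕ.* (b ℕ.+ c)) (p ℕ.* b) * shifted (+ p) (+ (b ℕ.+ c)) (s ℕ.+ u)
  binomial-shifted p b c s u =
    fact-cancel (p ℕ.* b) _ _ (fact-cancel (p ℕ.* c) _ _ (begin
      X * Ab * Ac * fact pb * fact pc         ≡⟨ regroup X Ab Ac (fact pb) (fact pc) ⟩
      X * ((fact pb * Ab) * (fact pc * Ac))
        ≡⟨ cong₂ (λ y z → X * (y * z)) (fact-shifted p b s) (fact-shifted p c u) ⟨
      X * (fact (pb ℕ.+ s) * fact (pc ℕ.+ u)) ≡⟨ cong (λ k → X * (fact (pb ℕ.+ s) * fact k)) complement ⟨
      X * (fact (pb ℕ.+ s) * fact (N ∸ (pb ℕ.+ s)))
                                              ≡⟨ Cℤ-factorials N (pb ℕ.+ s) (ℕP.+-mono-≤ pb≤ (ℕP.m≤m+n s u)) ⟩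
      fact N                                  ≡⟨ fact-shifted p (b ℕ.+ c) (s ℕ.+ u) ⟩
      fact (p ℕ.* (b ℕ.+ c)) * Abc            ≡⟨ cong (_* Abc) (Cℤ-factorials (p ℕ.* (b ℕ.+ c)) pb pb≤) ⟨
      Cp * (fact pb * fact (p ℕ.* (b ℕ.+ c) ∸ pb)) * Abc
                                              ≡⟨ cong (λ k → Cp * (fact pb * fact k) * Abc) complement₀ ⟩
      Cp * (fact pb * fact pc) * Abc          ≡⟨ regroup′ Cp (fact pb) (fact pc) Abc ⟩
      Cp * Abc * fact pb * fact pc            ∎))
    where
    open ≡-Reasoning
    pb pc N : ℕ
    pb = p ℕ.* b
    pc = p ℕ.* c
    N = p ℕ.* (b ℕ.+ c) ℕ.+ (s ℕ.+ u)
    X Cp Ab Ac Abc : ℤ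
    X = Cℤ N (pb ℕ.+ s)
    Cp = Cℤ (p ℕ.* (b ℕ.+ c)) pb
    Ab = shifted (+ p) (+ b) s
    Ac = shifted (+ p) (+ c) u
    Abc = shifted (+ p) (+ (b ℕ.+ c)) (s ℕ.+ u)
    pb≤ : pb ≤ p ℕ.* (b ℕ.+ c)
    pb≤ = ℕP.*-monoʳ-≤ p (ℕP.m≤m+n b c)
    complement₀ : p ℕ.* (b ℕ.+ c) ∸ pb ≡ pc
    complement₀ = trans (cong (_∸ pb) (ℕP.*-distribˡ-+ p b c)) (ℕP.m+n∸m≡n pb pc)
    complement : N ∸ (pb ℕ.+ s) ≡ pc ℕ.+ u
    complement = trans (cong (_∸ (pb ℕ.+ s)) (split p b c s u)) (ℕP.m+n∸m≡n (pb ℕ.+ s) (pc ℕ.+ u))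
      where
      split : ∀ p b c s u → p ℕ.* (b ℕ.+ c) ℕ.+ (s ℕ.+ u) ≡ (p ℕ.* b ℕ.+ s) ℕ.+ (p ℕ.* c ℕ.+ u)
      split = ℕSolver.solve-∀
    regroup : ∀ x a c f g → x * a * c * f * g ≡ x * ((f * a) * (g * c))
    regroup = solve-∀
    regroup′ : ∀ x f g a → x * (f * g) * a ≡ x * a * f * g
    regroup′ = solve-∀

  -- Evaluation of the shifted product at x = -1 for p = q + 1, where
  -- ∏_{i=1}^{n} (i - p) is, up to sign, a falling factorial of q.
  module _ (q : ℕ) where

    private
      P : ℤ
      P = + suc q

    shifted-neg-factor : ∀ n → n ≤ q → P * -1ℤ + + suc n ≡ - + (q ∸ n)
    shifted-neg-factor n n≤q = begin
      P * -1ℤ + + suc n   ≡⟨ swap P (+ suc n) ⟩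
      + suc n - P         ≡⟨ ℤP.m-n≡m⊖n (suc n) (suc q) ⟩
      suc n ℤ.⊖ suc q     ≡⟨ ℤP.⊖-≤ (s≤s n≤q) ⟩
      - + (q ∸ n)         ∎
      where
      open ≡-Reasoning
      swap : ∀ P m → P * -1ℤ + m ≡ m - P
      swap = solve-∀

    shifted-neg : ∀ n → n ≤ q → shifted P -1ℤ n * fact (q ∸ n) ≡ (-1ℤ ^ n) * fact q
    shifted-neg zero    _   = refl
    shifted-neg (suc n) n<q = begin
      shifted P -1ℤ n * (P * -1ℤ + + suc n) * fact (q ∸ suc n)
        ≡⟨ cong (λ y → shifted P -1ℤ n * y * fact (q ∸ suc n)) (shifted-neg-factor n (ℕP.<⇒≤ n<q)) ⟩
      shifted P -1ℤ n * - + (q ∸ n) * fact (q ∸ suc n)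
        ≡⟨ negate-out (shifted P -1ℤ n) (+ (q ∸ n)) (fact (q ∸ suc n)) ⟩
      -1ℤ * (shifted P -1ℤ n * (fact (q ∸ suc n) * + (q ∸ n)))
        ≡⟨ cong (λ y → -1ℤ * (shifted P -1ℤ n * y)) fact-peel ⟩
      -1ℤ * (shifted P -1ℤ n * fact (q ∸ n))
        ≡⟨ cong (-1ℤ *_) (shifted-neg n (ℕP.<⇒≤ n<q)) ⟩
      -1ℤ * ((-1ℤ ^ n) * fact q)
        ≡⟨ ℤP.*-assoc -1ℤ (-1ℤ ^ n) (fact q) ⟨
      (-1ℤ ^ suc n) * fact q ∎
      where
      open ≡-Reasoning
      q∸n≡1+q∸sn : q ∸ n ≡ suc (q ∸ suc n)
      q∸n≡1+q∸sn = ℕP.+-∸-assoc 1 n<q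
      fact-peel : fact (q ∸ suc n) * + (q ∸ n) ≡ fact (q ∸ n)
      fact-peel = begin
        fact (q ∸ suc n) * + (q ∸ n)          ≡⟨ cong (λ k → fact (q ∸ suc n) * + k) q∸n≡1+q∸sn ⟩
        fact (q ∸ suc n) * + suc (q ∸ suc n)  ≡⟨ fact-suc (q ∸ suc n) ⟨
        fact (suc (q ∸ suc n))                ≡⟨ cong fact q∸n≡1+q∸sn ⟨
        fact (q ∸ n)                          ∎
      negate-out : ∀ a m f → a * - m * f ≡ -1ℤ * (a * (f * m))
      negate-out = solve-∀

    -- For s + u ≤ q:  (-1)^u C(q - s, u) · u! · ∏_{i≤s}(i - p) = ∏_{i≤s+u}(i - p);
    -- both sides times (q - s - u)! equal (-1)^(s+u) q!.
    shifted-neg-binomial : ∀ s u → s ℕ.+ u ≤ q →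
      (-1ℤ ^ u) * Cℤ (q ∸ s) u * fact u * shifted P -1ℤ s ≡ shifted P -1ℤ (s ℕ.+ u)
    shifted-neg-binomial s u s+u≤q = fact-cancel (q ∸ (s ℕ.+ u)) _ _ (begin
      σ * Cℤ (q ∸ s) u * fact u * A s * fact (q ∸ (s ℕ.+ u))
        ≡⟨ cong (λ k → σ * Cℤ (q ∸ s) u * fact u * A s * fact k) (ℕP.∸-+-assoc q s u) ⟨
      σ * Cℤ (q ∸ s) u * fact u * A s * fact (q ∸ s ∸ u)
        ≡⟨ regroup σ (Cℤ (q ∸ s) u) (fact u) (A s) (fact (q ∸ s ∸ u)) ⟩
      σ * (Cℤ (q ∸ s) u * (fact u * fact (q ∸ s ∸ u))) * A s
        ≡⟨ cong (λ y → σ * y * A s) (Cℤ-factorials (q ∸ s) u u≤q∸s) ⟩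
      σ * fact (q ∸ s) * A s
        ≡⟨ regroup′ σ (fact (q ∸ s)) (A s) ⟩
      σ * (A s * fact (q ∸ s))
        ≡⟨ cong (σ *_) (shifted-neg s (ℕP.m+n≤o⇒m≤o s s+u≤q)) ⟩
      σ * ((-1ℤ ^ s) * fact q)
        ≡⟨ regroup″ σ (-1ℤ ^ s) (fact q) ⟩
      (-1ℤ ^ s) * σ * fact q
        ≡⟨ cong (_* fact q) (ℤP.^-distribˡ-+-* -1ℤ s u) ⟨
      (-1ℤ ^ (s ℕ.+ u)) * fact q
        ≡⟨ shifted-neg (s ℕ.+ u) s+u≤q ⟨
      A (s ℕ.+ u) * fact (q ∸ (s ℕ.+ u)) ∎)
      where
      open ≡-Reasoning
      σ : ℤ
      σ = -1ℤ ^ u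
      A : ℕ → ℤ
      A = shifted P -1ℤ
      u≤q∸s : u ≤ q ∸ s
      u≤q∸s = ℕP.m+n≤o⇒m≤o∸n u (subst (_≤ q) (ℕP.+-comm s u) s+u≤q)
      regroup : ∀ σ c f a g → σ * c * f * a * g ≡ σ * (c * (f * g)) * a
      regroup = solve-∀
      regroup′ : ∀ σ f a → σ * f * a ≡ σ * (a * f)
      regroup′ = solve-∀
      regroup″ : ∀ σ τ f → σ * (τ * f) ≡ τ * σ * f
      regroup″ = solve-∀

  -- Rationals as integer fractions:  a represents z / D  when ↥a · D = z · ↧a.
  -- The harmonic number H_n is represented by (n! H_n) / n!.
  module HarmonicFractions where

    open import Data.Rational as ℚ using (ℚ; _/_; ↥_; ↧_)
    import Data.Rational.Properties as ℚP
    open import Data.Rational.Unnormalised as ℚᵘ using (ℚᵘ; mkℚᵘ; *≡*)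
    import Data.Integer.GCD as ℤGCD
    open ≡-Reasoning

    infix 4 _represents_/_
    _represents_/_ : ℚᵘ → ℤ → ℕ → Set
    a represents z / D = ℚᵘ.↥ a * + D ≡ z * ℚᵘ.↧ a

    represents-≃ : ∀ a b z D → a ℚᵘ.≃ b → b represents z / D → a represents z / D
    represents-≃ a (mkℚᵘ nb db) z D (*≡* a≃b) b≈ = ℤP.*-cancelʳ-≡ _ _ (+ suc db) (begin
      ℚᵘ.↥ a * + D * + suc db   ≡⟨ swap (ℚᵘ.↥ a) (+ D) (+ suc db) ⟩
      ℚᵘ.↥ a * + suc db * + D   ≡⟨ cong (_* + D) a≃b ⟩
      nb * ℚᵘ.↧ a * + D         ≡⟨ swap nb (ℚᵘ.↧ a) (+ D) ⟩
      nb * + D * ℚᵘ.↧ a         ≡⟨ cong (_* ℚᵘ.↧ a) b≈ ⟩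
      z * + suc db * ℚᵘ.↧ a     ≡⟨ swap z (+ suc db) (ℚᵘ.↧ a) ⟩
      z * ℚᵘ.↧ a * + suc db     ∎)
      where
      swap : ∀ x y z → x * y * z ≡ x * z * y
      swap = solve-∀

    represents-+ : ∀ a b za zb Da Db → a represents za / Da → b represents zb / Db →
                   a ℚᵘ.+ b represents za * + Db + zb * + Da / Da ℕ.* Db
    represents-+ (mkℚᵘ na da) (mkℚᵘ nb db) za zb Da Db a≈ b≈ = begin
      (na * + suc db + nb * + suc da) * + (Da ℕ.* Db)
        ≡⟨ cong ((na * + suc db + nb * + suc da) *_) (ℤP.pos-* Da Db) ⟩
      (na * + suc db + nb * + suc da) * (+ Da * + Db)
        ≡⟨ spread na nb (+ suc da) (+ suc db) (+ Da) (+ Db) ⟩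
      + suc db * + Db * (na * + Da) + + suc da * + Da * (nb * + Db)
        ≡⟨ cong₂ (λ x y → + suc db * + Db * x + + suc da * + Da * y) a≈ b≈ ⟩
      + suc db * + Db * (za * + suc da) + + suc da * + Da * (zb * + suc db)
        ≡⟨ collect za zb (+ suc da) (+ suc db) (+ Da) (+ Db) ⟩
      (za * + Db + zb * + Da) * (+ suc da * + suc db)
        ≡⟨ cong ((za * + Db + zb * + Da) *_) (ℤP.pos-* (suc da) (suc db)) ⟨
      (za * + Db + zb * + Da) * + (suc da ℕ.* suc db) ∎
      where
      spread : ∀ na nb SA SB DA DB →
        (na * SB + nb * SA) * (DA * DB) ≡ SB * DB * (na * DA) + SA * DA * (nb * DB)
      spread = solve-∀
      collect : ∀ za zb SA SB DA DB →
        SB * DB * (za * SA) + SA * DA * (zb * SB) ≡ (za * DB + zb * DA) * (SA * SB)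
      collect = solve-∀

    represents-neg : ∀ a z D → a represents z / D → ℚᵘ.- a represents - z / D
    represents-neg (mkℚᵘ n d) z D a≈ =
      trans (sym (ℤP.neg-distribˡ-* n (+ D))) (trans (cong -_ a≈) (ℤP.neg-distribˡ-* z (+ suc d)))

    -- 1/(n+1), normalised, still represents 1/(n+1): both parts are divided by the gcd.
    represents-unitFraction : ∀ n → ℚ.toℚᵘ (+ 1 / suc n) represents + 1 / suc n
    represents-unitFraction n = begin
      ℚᵘ.↥ (ℚ.toℚᵘ x) * + suc n  ≡⟨ cong (_* + suc n) (ℚP.↥ᵘ-toℚᵘ x) ⟩
      ↥ x * + suc n          ≡⟨ cong (↥ x *_) (ℚP.↧-/ (+ 1) (suc n)) ⟨
      ↥ x * (↧ x * g)        ≡⟨ swap (↥ x) (↧ x) g ⟩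
      ↥ x * g * ↧ x          ≡⟨ cong (_* ↧ x) (ℚP.↥-/ (+ 1) (suc n)) ⟩
      + 1 * ↧ x              ≡⟨ cong (+ 1 *_) (ℚP.↧ᵘ-toℚᵘ x) ⟨
      + 1 * ℚᵘ.↧ (ℚ.toℚᵘ x)  ∎
      where
      x : ℚ
      x = + 1 / suc n
      g : ℤ
      g = ℤGCD.gcd (+ 1) (+ suc n)
      swap : ∀ a b c → a * (b * c) ≡ a * c * b
      swap = solve-∀

    represents-harmonic : ∀ n → ℚ.toℚᵘ (H n) represents hnum n / n !
    represents-harmonic zero    = refl
    represents-harmonic (suc n) =
      subst₂ (ℚ.toℚᵘ (H (suc n)) represents_/_) numerator (ℕP.*-comm (n !) (suc n))
        (represents-≃ (ℚ.toℚᵘ (H n ℚ.+ y)) (ℚ.toℚᵘ (H n) ℚᵘ.+ ℚ.toℚᵘ y)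
          (hnum n * + suc n + + 1 * fact n) (n ! ℕ.* suc n) (ℚP.toℚᵘ-homo-+ (H n) y)
          (represents-+ (ℚ.toℚᵘ (H n)) (ℚ.toℚᵘ y) (hnum n) (+ 1) (n !) (suc n)
            (represents-harmonic n) (represents-unitFraction n)))
      where
      y : ℚ
      y = + 1 / suc n
      numerator : hnum n * + suc n + + 1 * fact n ≡ hnum (suc n)
      numerator = trans (cong (λ z → hnum n * + suc n + z) (ℤP.*-identityˡ (fact n))) (sym (hnum-suc n))

    represents-harmonicDifference : ∀ r t →
      ℚ.toℚᵘ (H r ℚ.- H t) represents hnum r * fact t - hnum t * fact r / r ! ℕ.* t !
    represents-harmonicDifference r t =
      subst (λ z → ℚ.toℚᵘ (H r ℚ.- H t) represents z / r ! ℕ.* t !)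
        (cong (λ z → hnum r * fact t + z) (sym (ℤP.neg-distribˡ-* (hnum t) (fact r))))
        (represents-≃ (ℚ.toℚᵘ (H r ℚ.- H t)) (ℚ.toℚᵘ (H r) ℚᵘ.+ ℚ.toℚᵘ (ℚ.- H t))
          (hnum r * fact t + - hnum t * fact r) (r ! ℕ.* t !)
          (ℚP.toℚᵘ-homo-+ (H r) (ℚ.- H t))
          (represents-+ (ℚ.toℚᵘ (H r)) (ℚ.toℚᵘ (ℚ.- H t)) (hnum r) (- hnum t) (r !) (t !)
            (represents-harmonic r)
            (represents-≃ (ℚ.toℚᵘ (ℚ.- H t)) (ℚᵘ.- ℚ.toℚᵘ (H t)) (- hnum t) (t !) (ℚP.toℚᵘ-homo‿- (H t))
              (represents-neg (ℚ.toℚᵘ (H t)) (hnum t) (t !) (represents-harmonic t)))))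

  ≡ℤ⇒≈ : ∀ {x y n} → x ≡ℤ y [mod n ] → x ≈ y [mod + n ]
  ≡ℤ⇒≈ d = mod∣ (ℤ∣.∣ᵤ⇒∣ d)

  ≈⇒≡ℤ : ∀ {x y n} → x ≈ y [mod + n ] → x ≡ℤ y [mod n ]
  ≈⇒≡ℤ (mod∣ d) = ℤ∣.∣⇒∣ᵤ d

  module PrimeModulus (q : ℕ) (isPrime : Prime (suc q)) where

    open import Data.Nat.Divisibility as ℕ∣ using ()
    open import Data.Nat.Primality using (euclidsLemma; prime⇒nonZero; ¬prime[1])
    open import Data.Sum using (_⊎_; inj₁; inj₂)
    open import Relation.Nullary using (¬_; contradiction; yes; no)
    open import Data.Nat.Combinatorics using (k>n⇒nCk≡0)
    open import Data.Nat.Coprimality as ℕCoprime using ()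
    import Data.Rational as ℚ
    open import Function.Bundles using (Equivalence)
    open PrimeDivisibility q isPrime public using (p; p∤!; lucasStep; lucasMiddle; lucasMiddle-∣)
    open HarmonicFractions using (_represents_/_; represents-harmonicDifference)

    P : ℤ
    P = + p

    private instance
      p≢0 : ℕ.NonZero p
      p≢0 = prime⇒nonZero isPrime

    euclid : ∀ x y → P ∣ x * y → (P ∣ x) ⊎ (P ∣ y)
    euclid x y P∣xy
      with euclidsLemma ∣ x ∣ ∣ y ∣ isPrime (subst (p ℕ∣.∣_) (ℤP.abs-* x y) (ℤ∣.∣⇒∣ᵤ P∣xy))
    ... | inj₁ p∣x = inj₁ (ℤ∣.∣ᵤ⇒∣ p∣x)
    ... | inj₂ p∣y = inj₂ (ℤ∣.∣ᵤ⇒∣ p∣y)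

    P∣-cancel : ∀ x v → ¬ P ∣ v → P ∣ x * v → P ∣ x
    P∣-cancel x v P∤v P∣xv with euclid x v P∣xv
    ... | inj₁ P∣x = P∣x
    ... | inj₂ P∣v = contradiction P∣v P∤v

    P∤fact : ∀ n → n ℕ.< p → ¬ P ∣ fact n
    P∤fact n n<p P∣n! = p∤! n n<p (ℤ∣.∣⇒∣ᵤ P∣n!)

    P∤+multiple : ∀ m w → ¬ P ∣ m → ¬ P ∣ m + P * w
    P∤+multiple m w P∤m P∣m+Pw = P∤m (ℤ∣.∣m+n∣n⇒∣m P∣m+Pw (ℤ∣.∣m⇒∣m*n w (ℤ∣.∣-refl {P})))

    P²∣-cancel : ∀ y v → ¬ P ∣ v → P * P ∣ y * v → P * P ∣ y
    P²∣-cancel y v P∤v P²∣yv with P∣-cancel y v P∤v (ℤ∣.∣-trans (ℤ∣.∣m⇒∣m*n P ℤ∣.∣-refl) P²∣yv)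
    ... | divides y₁ refl = ℤ∣.*-monoˡ-∣ P (P∣-cancel y₁ v P∤v (ℤ∣.*-cancelʳ-∣ P P²∣Pyv))
      where
      P²∣Pyv : P * P ∣ y₁ * v * P
      P²∣Pyv = subst (P * P ∣_) (swap y₁ P v) P²∣yv
        where
        swap : ∀ a b c → a * b * c ≡ a * c * b
        swap = solve-∀

    P²∣P*⇒P∣ : ∀ z → P * P ∣ P * z → P ∣ z
    P²∣P*⇒P∣ z = ℤ∣.*-cancelˡ-∣ P

    P∣⇒P²∣P* : ∀ z → P ∣ z → P * P ∣ P * z
    P∣⇒P²∣P* z = ℤ∣.*-monoʳ-∣ P

    lucas : ∀ a b → Cℤ (p ℕ.* a) (p ℕ.* b) ≈ Cℤ a b [mod P * P ]
    lucas zero    zero    rewrite ℕP.*-zeroʳ p = ≈-refl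
    lucas zero    (suc b) rewrite ℕP.*-zeroʳ p = ≈-refl
    lucas (suc a) zero    rewrite ℕP.*-zeroʳ p = ≈-refl
    lucas (suc a) (suc b) = begin
      Cℤ (p ℕ.* suc a) (p ℕ.* suc b)                         ≡⟨ cong +_ (lucasStep a b) ⟩
      + ((p ℕ.* a) C (p ℕ.* suc b) ℕ.+ M ℕ.+ (p ℕ.* a) C (p ℕ.* b))
                                                           ≡⟨ cast ⟩
      Cℤ (p ℕ.* a) (p ℕ.* suc b) + + M + Cℤ (p ℕ.* a) (p ℕ.* b)
                                                           ≈⟨ ≈-+ (≈-+ (lucas a (suc b)) middle≈0) (lucas a b) ⟩
      Cℤ a (suc b) + 0ℤ + Cℤ a b                           ≡⟨ pascal ⟩
      Cℤ (suc a) (suc b)                                   ∎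
      where
      open ≈-Reasoning (P * P)
      M : ℕ
      M = lucasMiddle a b
      cast : + ((p ℕ.* a) C (p ℕ.* suc b) ℕ.+ M ℕ.+ (p ℕ.* a) C (p ℕ.* b))
             ≡ Cℤ (p ℕ.* a) (p ℕ.* suc b) + + M + Cℤ (p ℕ.* a) (p ℕ.* b)
      cast = trans (ℤP.pos-+ _ ((p ℕ.* a) C (p ℕ.* b)))
                   (cong (_+ Cℤ (p ℕ.* a) (p ℕ.* b)) (ℤP.pos-+ ((p ℕ.* a) C (p ℕ.* suc b)) M))
      middle≈0 : + M ≈ 0ℤ [mod P * P ]
      middle≈0 =
        ∣⇒≈0 (subst (_∣ + M) (ℤP.pos-* p p) (ℤ∣.∣ᵤ⇒∣ {+ (p ℕ.* p)} {+ M} (lucasMiddle-∣ a b)))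
      pascal : Cℤ a (suc b) + 0ℤ + Cℤ a b ≡ Cℤ (suc a) (suc b)
      pascal = ≡.begin
        Cℤ a (suc b) + 0ℤ + Cℤ a b  ≡.≡⟨ cong (_+ Cℤ a b) (ℤP.+-identityʳ (Cℤ a (suc b))) ⟩
        Cℤ a (suc b) + Cℤ a b       ≡.≡⟨ ℤP.+-comm (Cℤ a (suc b)) (Cℤ a b) ⟩
        Cℤ a b + Cℤ a (suc b)       ≡.≡⟨ ℤP.pos-+ (a C b) (a C suc b) ⟨
        + (a C b ℕ.+ a C suc b)     ≡.≡⟨ cong +_ (nCk+nC[k+1]≡[n+1]C[k+1] a b) ⟩
        Cℤ (suc a) (suc b)          ≡.∎
        where module ≡ = ≡-Reasoning

    -- If a rational x is represented by N / D with p ∤ D, then p divides the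
    -- numerator of x iff P ∣ N.  (Its reduced numerator and denominator are coprime.)
    numerator-criterion : ∀ x N D → ℚ.toℚᵘ x represents N / D → ¬ p ℕ∣.∣ D →
                          p ℕ∣.∣ ∣ ℚ.↥ x ∣ ⇔ P ∣ N
    numerator-criterion x@(ℚ.mkℚ n d coprime) N D x≈ p∤D = mk⇔ to from
      where
      cross : ∣ n ∣ ℕ.* D ≡ ∣ N ∣ ℕ.* suc d
      cross = trans (sym (ℤP.abs-* n (+ D))) (trans (cong ∣_∣ x≈) (ℤP.abs-* N (+ suc d)))
      to : p ℕ∣.∣ ∣ n ∣ → P ∣ N
      to p∣n with euclidsLemma ∣ N ∣ (suc d) isPrime (subst (p ℕ∣.∣_) cross (ℕ∣.∣m⇒∣m*n D p∣n))
      ... | inj₁ p∣N = ℤ∣.∣ᵤ⇒∣ p∣N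
      ... | inj₂ p∣d = contradiction (ℕCoprime.recompute coprime (p∣n , p∣d)) p≢1
        where
        p≢1 : p ≢ 1
        p≢1 refl = ¬prime[1] isPrime
      from : P ∣ N → p ℕ∣.∣ ∣ n ∣
      from P∣N
        with euclidsLemma ∣ n ∣ D isPrime (subst (p ℕ∣.∣_) (sym cross) (ℕ∣.∣m⇒∣m*n (suc d) (ℤ∣.∣⇒∣ᵤ P∣N)))
      ... | inj₁ p∣n = p∣n
      ... | inj₂ p∣D = contradiction p∣D p∤D

    -- The integral form of H_r ≡ H_t (mod p):  r! H_r · t! ≡ t! H_t · r!.
    HarmonicCong : ℕ → ℕ → Set
    HarmonicCong r t = hnum r * fact t ≈ hnum t * fact r [mod P ]

    harmonic-criterion : ∀ r t → r ℕ.< p → t ℕ.< p → (H r ≡ℚ H t [mod p ]) ⇔ HarmonicCong r t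
    harmonic-criterion r t r<p t<p = mk⇔ (λ h → mod∣ (to h)) (λ h → from (difference-divisible h))
      where
      p∤r!t! : ¬ p ℕ∣.∣ r ! ℕ.* t !
      p∤r!t! p∣ with euclidsLemma (r !) (t !) isPrime p∣
      ... | inj₁ p∣r! = p∤! r r<p p∣r!
      ... | inj₂ p∣t! = p∤! t t<p p∣t!
      open Equivalence (numerator-criterion (H r ℚ.- H t) (hnum r * fact t - hnum t * fact r) (r ! ℕ.* t !)
                          (represents-harmonicDifference r t) p∤r!t!)

    -- Transitivity through an index b < p, whose factorial is a unit mod p:
    -- b!(E_a c! - E_c a!) = c!(E_a b! - E_b a!) + a!(E_b c! - E_c b!).
    HarmonicCong-trans : ∀ a b c → b ℕ.< p → HarmonicCong a b → HarmonicCong b c → HarmonicCong a c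
    HarmonicCong-trans a b c b<p (mod∣ ab) (mod∣ bc) = mod∣ (P∣-cancel _ (fact b) (P∤fact b b<p)
      (subst (P ∣_) (through (hnum a) (hnum b) (hnum c) (fact a) (fact b) (fact c))
        (ℤ∣.∣m∣n⇒∣m+n (ℤ∣.∣n⇒∣m*n (fact c) ab) (ℤ∣.∣n⇒∣m*n (fact a) bc))))
      where
      through : ∀ ea eb ec fa fb fc →
        fc * (ea * fb - eb * fa) + fa * (eb * fc - ec * fb) ≡ (ea * fc - ec * fa) * fb
      through = solve-∀

    ≡ℤ[p²]⇔≈ : ∀ x y → (x ≡ℤ y [mod p ℕ.* p ]) ⇔ (x ≈ y [mod P * P ])
    ≡ℤ[p²]⇔≈ x y = mk⇔ (λ c → subst (x ≈ y [mod_]) (ℤP.pos-* p p) (≡ℤ⇒≈ c))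
                      (λ c → ≈⇒≡ℤ (subst (x ≈ y [mod_]) (sym (ℤP.pos-* p p)) c))

    module Pair (s u : ℕ) (r≤q : s ℕ.+ u ℕ.≤ q) where

      r : ℕ
      r = s ℕ.+ u

      crs : ℤ
      crs = Cℤ r s

      s<p : s ℕ.< p
      s<p = s≤s (ℕP.m+n≤o⇒m≤o s r≤q)

      u<p : u ℕ.< p
      u<p = s≤s (ℕP.m+n≤o⇒n≤o s r≤q)

      r<p : r ℕ.< p
      r<p = s≤s r≤q

      fact-r : fact r ≡ crs * (fact s * fact u)
      fact-r = sym (trans (cong (λ k → crs * (fact s * fact k)) (sym (ℕP.m+n∸m≡n s u)))
                          (Cℤ-factorials r s (ℕP.m≤m+n s u)))

      P∤s!u! : ¬ P ∣ fact s * fact u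
      P∤s!u! P∣ with euclid (fact s) (fact u) P∣
      ... | inj₁ P∣s! = P∤fact s s<p P∣s!
      ... | inj₂ P∣u! = P∤fact u u<p P∣u!

      Δ : ℕ → ℤ
      Δ t = hnum r * fact t - hnum t * fact r

      -- The quantities attached to the upper digits a = b + c and b.
      X : ℕ → ℕ → ℤ
      X b c = Cℤ (p ℕ.* (b ℕ.+ c) ℕ.+ r) (p ℕ.* b ℕ.+ s)

      Cab : ℕ → ℕ → ℤ
      Cab b c = Cℤ (b ℕ.+ c) b

      W : ℕ → ℕ → ℤ
      W b c = + b * hnum s * fact u + + c * hnum u * fact s

      Z : ℕ → ℕ → ℤ
      Z b c = + (b ℕ.+ c) * hnum r - crs * W b c

      U : ℕ → ℕ → ℤ
      U b c = fact s * fact u + P * W b c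

      Z-identity : ∀ b c → Z b c * (fact s * fact u) ≡ + b * fact u * Δ s + + c * fact s * Δ u
      Z-identity b c = begin
        Z b c * (fact s * fact u)
          ≡⟨ cong (λ B → (B * hnum r - crs * W b c) * (fact s * fact u)) (ℤP.pos-+ b c) ⟩
        ((+ b + + c) * hnum r - crs * W b c) * (fact s * fact u)
          ≡⟨ expand (+ b) (+ c) (hnum r) (hnum s) (hnum u) (fact s) (fact u) crs ⟩
        + b * fact u * (hnum r * fact s - hnum s * (crs * (fact s * fact u)))
          + + c * fact s * (hnum r * fact u - hnum u * (crs * (fact s * fact u)))
          ≡⟨ cong (λ F → + b * fact u * (hnum r * fact s - hnum s * F)
                         + + c * fact s * (hnum r * fact u - hnum u * F)) fact-r ⟨
        + b * fact u * Δ s + + c * fact s * Δ u ∎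
        where
        open ≡-Reasoning
        expand : ∀ b c er es eu fs fu crs →
          ((b + c) * er - crs * (b * es * fu + c * eu * fs)) * (fs * fu)
            ≡ b * fu * (er * fs - es * (crs * (fs * fu))) + c * fs * (er * fu - eu * (crs * (fs * fu)))
        expand = solve-∀

      shifted-pair : ∀ b c → shifted P (+ b) s * shifted P (+ c) u ≈ U b c [mod P * P ]
      shifted-pair b c = begin
        shifted P (+ b) s * shifted P (+ c) u
          ≈⟨ ≈-* (shifted-expansion P (+ b) s) (shifted-expansion P (+ c) u) ⟩
        (fact s + P * + b * hnum s) * (fact u + P * + c * hnum u)
          ≡⟨ expand (fact s) (fact u) (+ b) (+ c) (hnum s) (hnum u) P ⟩
        fact s * fact u + P * W b c + + b * + c * hnum s * hnum u * (P * P)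
          ≈⟨ ≈-+multiple _ (+ b * + c * hnum s * hnum u) ⟩
        fact s * fact u + P * W b c ∎
        where
        open ≈-Reasoning (P * P)
        expand : ∀ fs fu b c es eu P → (fs + P * b * es) * (fu + P * c * eu)
          ≡ fs * fu + P * (b * es * fu + c * eu * fs) + b * c * es * eu * (P * P)
        expand = solve-∀

      -- The key congruence:  (X - C(a,b) C(r,s)) (s! u! + p W) ≡ p C(a,b) Z  (mod p²).
      -- It compares the two sides of `binomial-shifted` expanded to first order in p.
      key-congruence : ∀ b c → (X b c - Cab b c * crs) * U b c ≈ P * (Cab b c * Z b c) [mod P * P ]
      key-congruence b c = begin
        (X b c - Cab b c * crs) * U b c             ≡⟨ distribute (X b c) (Cab b c) crs (U b c) ⟩
        X b c * U b c - Cab b c * (crs * U b c)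
          ≈⟨ ≈-+ʳ (- (Cab b c * (crs * U b c))) (≈-*ˡ (X b c) (≈-sym (shifted-pair b c))) ⟩
        X b c * (Ab * Ac) - Cab b c * (crs * U b c) ≡⟨ cong (_- Cab b c * (crs * U b c)) binomial ⟩
        Cp * Abc - Cab b c * (crs * U b c)
          ≈⟨ ≈-+ʳ (- (Cab b c * (crs * U b c)))
                 (≈-* (lucas (b ℕ.+ c) b) (shifted-expansion P (+ (b ℕ.+ c)) r)) ⟩
        Cab b c * (fact r + P * + (b ℕ.+ c) * hnum r) - Cab b c * (crs * U b c)
          ≡⟨ cong (λ F → Cab b c * (F + P * + (b ℕ.+ c) * hnum r) - Cab b c * (crs * U b c)) fact-r ⟩
        Cab b c * (crs * (fact s * fact u) + P * + (b ℕ.+ c) * hnum r) - Cab b c * (crs * U b c)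
          ≡⟨ collect (Cab b c) crs (fact s * fact u) P (+ (b ℕ.+ c)) (hnum r) (W b c) ⟩
        P * (Cab b c * Z b c) ∎
        where
        open ≈-Reasoning (P * P)
        Ab Ac Abc Cp : ℤ
        Ab = shifted P (+ b) s
        Ac = shifted P (+ c) u
        Abc = shifted P (+ (b ℕ.+ c)) r
        Cp = Cℤ (p ℕ.* (b ℕ.+ c)) (p ℕ.* b)
        binomial : X b c * (Ab * Ac) ≡ Cp * Abc
        binomial = trans (sym (ℤP.*-assoc (X b c) Ab Ac)) (binomial-shifted p b c s u)
        distribute : ∀ x y z v → (x - y * z) * v ≡ x * v - y * (z * v)
        distribute = solve-∀
        collect : ∀ cab crs f P a e w →
          cab * (crs * f + P * a * e) - cab * (crs * (f + P * w)) ≡ P * (cab * (a * e - crs * w))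
        collect = solve-∀

      P∤unit : ∀ b c → ¬ P ∣ U b c
      P∤unit b c = P∤+multiple (fact s * fact u) (W b c) P∤s!u!

      Z-divisible : HarmonicCong r s → HarmonicCong r u → ∀ b c → P ∣ Z b c
      Z-divisible (mod∣ P∣Δs) (mod∣ P∣Δu) b c = P∣-cancel (Z b c) (fact s * fact u) P∤s!u!
        (subst (P ∣_) (sym (Z-identity b c))
          (ℤ∣.∣m∣n⇒∣m+n (ℤ∣.∣n⇒∣m*n (+ b * fact u) P∣Δs) (ℤ∣.∣n⇒∣m*n (+ c * fact s) P∣Δu)))

      harmonic⇒binomial : HarmonicCong r s → HarmonicCong r u →
                          ∀ b c → X b c ≈ Cab b c * crs [mod P * P ]
      harmonic⇒binomial hs hu b c = mod∣ (P²∣-cancel _ _ (P∤unit b c) (≈0⇒∣ (begin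
        (X b c - Cab b c * crs) * U b c  ≈⟨ key-congruence b c ⟩
        P * (Cab b c * Z b c)
          ≈⟨ ∣⇒≈0 (P∣⇒P²∣P* _ (ℤ∣.∣n⇒∣m*n (Cab b c) (Z-divisible hs hu b c))) ⟩
        0ℤ ∎)))
        where open ≈-Reasoning (P * P)

      binomial⇒divisible : ∀ b c → X b c ≈ Cab b c * crs [mod P * P ] → P ∣ Cab b c * Z b c
      binomial⇒divisible b c X≈ = P²∣P*⇒P∣ _ (≈0⇒∣ (begin
        P * (Cab b c * Z b c)   ≈⟨ ≈-sym (key-congruence b c) ⟩
        (X b c - Cab b c * crs) * U b c  ≈⟨ ≈-*ʳ (U b c) (∣⇒≈0 (difference-divisible X≈)) ⟩
        0ℤ * U b c                       ≡⟨ ℤP.*-zeroˡ (U b c) ⟩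
        0ℤ ∎))
        where open ≈-Reasoning (P * P)

      -- With (a, b) = (1, 1), i.e. b = 1, c = 0, this yields H_r ≡ H_s;
      -- with (a, b) = (1, 0), i.e. b = 0, c = 1, it yields H_r ≡ H_u.
      binomial⇒harmonic-s : X 1 0 ≈ Cab 1 0 * crs [mod P * P ] → HarmonicCong r s
      binomial⇒harmonic-s X≈ = mod∣ (P∣-cancel (Δ s) (fact u) (P∤fact u u<p)
        (subst (P ∣_) (trans (Z-identity 1 0) (only-s (fact u) (fact s) (Δ s) (Δ u)))
          (ℤ∣.∣m⇒∣m*n (fact s * fact u) (subst (P ∣_) (ℤP.*-identityˡ (Z 1 0)) (binomial⇒divisible 1 0 X≈)))))
        where
        only-s : ∀ fu fs δs δu → + 1 * fu * δs + + 0 * fs * δu ≡ δs * fu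
        only-s = solve-∀

      binomial⇒harmonic-u : X 0 1 ≈ Cab 0 1 * crs [mod P * P ] → HarmonicCong r u
      binomial⇒harmonic-u X≈ = mod∣ (P∣-cancel (Δ u) (fact s) (P∤fact s s<p)
        (subst (P ∣_) (trans (Z-identity 0 1) (only-u (fact u) (fact s) (Δ s) (Δ u)))
          (ℤ∣.∣m⇒∣m*n (fact s * fact u) (subst (P ∣_) (ℤP.*-identityˡ (Z 0 1)) (binomial⇒divisible 0 1 X≈)))))
        where
        only-u : ∀ fu fs δs δu → + 0 * fu * δs + + 1 * fs * δu ≡ δu * fs
        only-u = solve-∀

      -- For a < b both sides of the defining congruence of D(p) vanish,
      -- as pa + r < p(a + 1) ≤ pb + s.
      lower-vanishes : ∀ a b → a ℕ.< b →
        Cℤ (p ℕ.* a ℕ.+ r) (p ℕ.* b ℕ.+ s) ≡ℤ Cℤ a b * crs [mod p ℕ.* p ]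
      lower-vanishes a b a<b = ≈⇒≡ℤ (≈-reflexive (begin
        Cℤ (p ℕ.* a ℕ.+ r) (p ℕ.* b ℕ.+ s)  ≡⟨ cong +_ (k>n⇒nCk≡0 top<bottom) ⟩
        0ℤ                                  ≡⟨ ℤP.*-zeroˡ crs ⟨
        0ℤ * crs                            ≡⟨ cong (λ k → + k * crs) (k>n⇒nCk≡0 a<b) ⟨
        Cℤ a b * crs                        ∎))
        where
        open ≡-Reasoning
        top<bottom : p ℕ.* a ℕ.+ r ℕ.< p ℕ.* b ℕ.+ s
        top<bottom = ℕP.<-≤-trans (ℕP.+-monoʳ-< (p ℕ.* a) r<p)
          (ℕP.≤-trans (ℕP.≤-reflexive (trans (ℕP.+-comm (p ℕ.* a) p) (sym (ℕP.*-suc p a))))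
            (ℕP.≤-trans (ℕP.*-monoʳ-≤ p a<b) (ℕP.m≤m+n (p ℕ.* b) s)))

      -- (r, s) ∈ D(p)  iff  r! H_r · s! ≡ s! H_s · r!  and  r! H_r · u! ≡ u! H_u · r!  (mod p).
      -- Forward: take (a, b) = (1, 1) and (1, 0).  Backward: write a = b + c when b ≤ a.
      inD⇔harmonic : InD p r s ⇔ (HarmonicCong r s × HarmonicCong r u)
      inD⇔harmonic = mk⇔ {A = InD p r s} {B = HarmonicCong r s × HarmonicCong r u}
        (λ d → harmonic-s d , harmonic-u d) (λ (hs , hu) → inD hs hu)
        where
        harmonic-s : InD p r s → HarmonicCong r s
        harmonic-s d = binomial⇒harmonic-s (Equivalence.to (≡ℤ[p²]⇔≈ (X 1 0) (Cab 1 0 * crs)) (d 1 1))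
        harmonic-u : InD p r s → HarmonicCong r u
        harmonic-u d = binomial⇒harmonic-u (Equivalence.to (≡ℤ[p²]⇔≈ (X 0 1) (Cab 0 1 * crs)) (d 1 0))
        inD : HarmonicCong r s → HarmonicCong r u → InD p r s
        inD hs hu a b with b ℕ.≤? a
        ... | no  b≰a = lower-vanishes a b (ℕP.≰⇒> b≰a)
        ... | yes b≤a = subst (λ a → Cℤ (p ℕ.* a ℕ.+ r) (p ℕ.* b ℕ.+ s) ≡ℤ Cℤ a b * crs [mod p ℕ.* p ])
          (ℕP.m+[n∸m]≡n b≤a)
          (Equivalence.from (≡ℤ[p²]⇔≈ (X b (a ∸ b)) (Cab b (a ∸ b) * crs)) (harmonic⇒binomial hs hu b (a ∸ b)))

      -- The value (-1)^u C(q - s, u) that C(r, s) takes when the harmonic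
      -- congruence for s holds, and the corresponding defect Y.
      V : ℤ
      V = (-1ℤ ^ u) * Cℤ (q ∸ s) u

      Y : ℤ
      Y = hnum r - crs * fact u * hnum s

      U⁻ : ℤ
      U⁻ = fact s * fact u + P * - (fact u * hnum s)

      P∤U⁻ : ¬ P ∣ U⁻
      P∤U⁻ = P∤+multiple (fact s * fact u) (- (fact u * hnum s)) P∤s!u!

      Y-identity : Y * fact s ≡ Δ s
      Y-identity = trans (expand (hnum r) crs (fact s) (fact u) (hnum s))
                         (cong (λ F → hnum r * fact s - hnum s * F) (sym fact-r))
        where
        expand : ∀ er crs fs fu es → (er - crs * fu * es) * fs ≡ er * fs - es * (crs * (fs * fu))
        expand = solve-∀

      -- (C(r,s) - V)(s! u! - p u! E_s) ≡ p Y  (mod p²): the identity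
      -- V u! ∏_{i≤s}(i - p) = ∏_{i≤r}(i - p) expanded to first order in p.
      key-congruence-neg : (crs - V) * U⁻ ≈ P * Y [mod P * P ]
      key-congruence-neg = begin
        (crs - V) * U⁻                                ≡⟨ distribute crs V (fact s) (fact u) (hnum s) P ⟩
        crs * U⁻ - V * fact u * (fact s + P * -1ℤ * hnum s)
          ≈⟨ ≈-+ˡ (crs * U⁻) (≈-neg (≈-*ˡ (V * fact u) (≈-sym (shifted-expansion P -1ℤ s)))) ⟩
        crs * U⁻ - V * fact u * shifted P -1ℤ s
          ≡⟨ cong (λ t → crs * U⁻ - t) (shifted-neg-binomial q s u r≤q) ⟩
        crs * U⁻ - shifted P -1ℤ r
          ≈⟨ ≈-+ˡ (crs * U⁻) (≈-neg (shifted-expansion P -1ℤ r)) ⟩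
        crs * U⁻ - (fact r + P * -1ℤ * hnum r)
          ≡⟨ cong (λ F → crs * U⁻ - (F + P * -1ℤ * hnum r)) fact-r ⟩
        crs * U⁻ - (crs * (fact s * fact u) + P * -1ℤ * hnum r)
                                                      ≡⟨ collect crs (fact s) (fact u) (hnum s) (hnum r) P ⟩
        P * Y                                         ∎
        where
        open ≈-Reasoning (P * P)
        distribute : ∀ c v fs fu es P → (c - v) * (fs * fu + P * - (fu * es))
                     ≡ c * (fs * fu + P * - (fu * es)) - v * fu * (fs + P * -1ℤ * es)
        distribute = solve-∀
        collect : ∀ c fs fu es er P →
          c * (fs * fu + P * - (fu * es)) - (c * (fs * fu) + P * -1ℤ * er) ≡ P * (er - c * fu * es)
        collect = solve-∀

      binomial-criterion : (crs ≈ V [mod P * P ]) ⇔ HarmonicCong r s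
      binomial-criterion = mk⇔ {A = crs ≈ V [mod P * P ]} {B = HarmonicCong r s} to from
        where
        open ≈-Reasoning (P * P)
        to : crs ≈ V [mod P * P ] → HarmonicCong r s
        to crs≈V = mod∣ (subst (P ∣_) Y-identity (ℤ∣.∣m⇒∣m*n (fact s) (P²∣P*⇒P∣ Y (≈0⇒∣ (begin
          P * Y            ≈⟨ ≈-sym key-congruence-neg ⟩
          (crs - V) * U⁻   ≈⟨ ≈-*ʳ U⁻ (∣⇒≈0 (difference-divisible crs≈V)) ⟩
          0ℤ * U⁻          ≡⟨ ℤP.*-zeroˡ U⁻ ⟩
          0ℤ               ∎)))))
        from : HarmonicCong r s → crs ≈ V [mod P * P ]
        from (mod∣ P∣Δs) = mod∣ (P²∣-cancel (crs - V) U⁻ P∤U⁻ (≈0⇒∣ (begin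
          (crs - V) * U⁻   ≈⟨ key-congruence-neg ⟩
          P * Y            ≈⟨ ∣⇒≈0 (P∣⇒P²∣P* Y P∣Y) ⟩
          0ℤ               ∎)))
          where
          P∣Y : P ∣ Y
          P∣Y = P∣-cancel Y (fact s) (P∤fact s s<p) (subst (P ∣_) (sym Y-identity) P∣Δs)

  Characterisation : ℕ → ℕ → ℕ → ℕ → Set
  Characterisation p r s u =
      (InD p r s ⇔ ((H r ≡ℚ H u [mod p ]) × (H u ≡ℚ H s [mod p ])))
    × (InD p r s ⇔ ((Cℤ r s ≡ℤ (-1ℤ ^ u) * Cℤ (p ∸ 1 ∸ s) u [mod p ℕ.* p ])
                    × ((-1ℤ ^ u) * Cℤ (p ∸ 1 ∸ s) u ≡ℤ (-1ℤ ^ s) * Cℤ (p ∸ 1 ∸ r ℕ.+ s) s [mod p ℕ.* p ])))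

  module _ (q : ℕ) (isPrime : Prime (suc q)) (s u : ℕ) (r≤q : s ℕ.+ u ≤ q) where

    open PrimeModulus q isPrime
    open Pair s u r≤q

    harmonic-pair : ((H r ≡ℚ H u [mod p ]) × (H u ≡ℚ H s [mod p ])) ⇔ (HarmonicCong r s × HarmonicCong r u)
    harmonic-pair = ⇔.trans (harmonic-criterion r u r<p u<p ×-⇔ harmonic-criterion u s u<p s<p)
      (mk⇔ {A = HarmonicCong r u × HarmonicCong u s} {B = HarmonicCong r s × HarmonicCong r u}
        (λ (hru , hus) → HarmonicCong-trans r u s u<p hru hus , hru)
        (λ (hrs , hru) → hru , HarmonicCong-trans u r s r<p (≈-sym hru) hrs))

    -- The value (-1)^s C(q - u, s) predicted for C(r, s) = C(r, u) by the
    -- congruence for u, written as in the theorem.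
    V′ : ℤ
    V′ = (-1ℤ ^ s) * Cℤ (q ∸ r ℕ.+ s) s

    binomial-criterion′ : (crs ≈ V′ [mod P * P ]) ⇔ HarmonicCong r u
    binomial-criterion′ = subst₂ _⇔_ (cong₂ (λ C k → C ≈ (-1ℤ ^ s) * Cℤ k s [mod P * P ]) C-sym q∸u)
                                     (cong (λ n → HarmonicCong n u) (ℕP.+-comm u s))
                            (Pair.binomial-criterion u s (subst (_≤ q) (ℕP.+-comm s u) r≤q))
      where
      C-sym : Cℤ (u ℕ.+ s) u ≡ crs
      C-sym = cong +_ (trans (cong (_C u) (ℕP.+-comm u s))
        (trans (cong (r C_) (sym (ℕP.m+n∸m≡n s u))) (sym (nCk≡nC[n∸k] (ℕP.m≤m+n s u)))))
      q∸u : q ∸ u ≡ q ∸ r ℕ.+ s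
      q∸u = begin
        q ∸ u                              ≡⟨ cong (_∸ u) (ℕP.m∸n+n≡m r≤q) ⟨
        (q ∸ r) ℕ.+ (s ℕ.+ u) ∸ u          ≡⟨ cong (_∸ u) (ℕP.+-assoc (q ∸ r) s u) ⟨
        (q ∸ r) ℕ.+ s ℕ.+ u ∸ u            ≡⟨ ℕP.m+n∸n≡m ((q ∸ r) ℕ.+ s) u ⟩
        q ∸ r ℕ.+ s                        ∎
        where open ≡-Reasoning

    binomial-pair : ((crs ≡ℤ V [mod p ℕ.* p ]) × (V ≡ℤ V′ [mod p ℕ.* p ]))
                    ⇔ (HarmonicCong r s × HarmonicCong r u)
    binomial-pair = ⇔.trans (≡ℤ[p²]⇔≈ crs V ×-⇔ ≡ℤ[p²]⇔≈ V V′)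
      (⇔.trans (mk⇔ {A = (crs ≈ V [mod P * P ]) × (V ≈ V′ [mod P * P ])}
                    {B = (crs ≈ V [mod P * P ]) × (crs ≈ V′ [mod P * P ])}
                    (λ (c≈V , V≈V′) → c≈V , ≈-trans c≈V V≈V′)
                    (λ (c≈V , c≈V′) → c≈V , ≈-trans (≈-sym c≈V) c≈V′))
               (binomial-criterion ×-⇔ binomial-criterion′))

    characterisation : Characterisation p r s u
    characterisation = ⇔.trans inD⇔harmonic (⇔.sym harmonic-pair)
                     , ⇔.trans inD⇔harmonic (⇔.sym binomial-pair)

open Arithmetic using (Characterisation; characterisation)
open import Data.Nat using (zero; _≤_; _∸_; _*_; _+_)
open import Data.Nat.Primality using (¬prime[0])
open import Data.Nat.Properties using (m+[n∸m]≡n)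
open import Data.Integer as ℤ using (-1ℤ)
open import Data.Product using (_×_)
open import Data.Empty using (⊥-elim)
open import Function.Bundles using (_⇔_)
open import Relation.Binary.PropositionalEquality using (_≡_; subst; sym)

theorem8 : (p : ℕ) → Prime p → (r s : ℕ) → s ≤ r → r ≤ p ∸ 1 →
    (InD p r s ⇔ ((H r ≡ℚ H (r ∸ s) [mod p ]) × (H (r ∸ s) ≡ℚ H s [mod p ])))
    × (InD p r s ⇔ ((Cℤ r s ≡ℤ (-1ℤ ℤ.^ (r ∸ s)) ℤ.* Cℤ (p ∸ 1 ∸ s) (r ∸ s) [mod p * p ])
                    × ((-1ℤ ℤ.^ (r ∸ s)) ℤ.* Cℤ (p ∸ 1 ∸ s) (r ∸ s)
                        ≡ℤ (-1ℤ ℤ.^ s) ℤ.* Cℤ (p ∸ 1 ∸ r + s) s [mod p * p ])))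
theorem8 zero    isPrime = ⊥-elim (¬prime[0] isPrime)
theorem8 (suc q) isPrime r s s≤r r≤q =
  subst (λ r′ → Characterisation (suc q) r′ s (r ∸ s)) r≡s+u
    (characterisation q isPrime s (r ∸ s) (subst (_≤ q) (sym r≡s+u) r≤q))
  where
  r≡s+u : s + (r ∸ s) ≡ r
  r≡s+u = m+[n∸m]≡n s≤r
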